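{- Let $N\ge 3$ be an integer and let $n=\varphi(N)$ (Euler's totient, which is even). For every ABC-solution $\mathbf{a}=(a,b,c)$, writing $(A,B,C)=\Theta_n(\mathbf{a})$, we have $N\mid ABC$.
   Context: An ABC-solution is a triple $(a,b,c)$ of distinct integers with $\gcd(a,b,c)=1$, $a+b+c=0$, and $a<0$, $b<0$ (so $c>0$). For a positive even integer $n$ and an ABC-solution $\mathbf{a}=(a,b,c)$, define $\Theta_n(\mathbf{a})=\bigl(-2^{ -m}(a-b)^n,\ -2^{ -m}[c^n-(a-b)^n],\ 2^{ -m}c^n\bigr)$, where $m=n$ if $c$ is even and $m=0$ if $c$ is odd; this is again an ABC-solution. -}

module Defs where

open import Data.Nat as ℕ using (ℕ; suc)
open import Data.Nat.GCD as NG using ()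
open import Data.Nat.Divisibility as ND using ()
open import Data.Integer as ℤ using (ℤ; +_; _+_; _-_; _*_; -_; _<_; _^_; 0ℤ)
open import Data.Integer.DivMod using (_/ℕ_)
open import Data.Integer.GCD using (gcd)
open import Data.Nat.Properties using (m^n≢0)
open import Data.List using (List; length; filter; upTo)
open import Data.Product using (_×_; _,_)
open import Relation.Binary.PropositionalEquality using (_≡_; _≢_)
open import Relation.Nullary using (Dec)
open import Data.Bool using (if_then_else_)
open import Relation.Nullary using (does)

φ : ℕ → ℕ
φ N = length (filter (λ k → NG.gcd (suc k) N ℕ.≟ 1) (upTo N))

record IsABC (a b c : ℤ) : Set where
  field
    a≢b   : a ≢ b
    a≢c   : a ≢ c
    b≢c   : b ≢ c
    gcd≡1 : gcd (gcd a b) c ≡ + 1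
    sum≡0 : a + b + c ≡ 0ℤ
    a<0   : a < 0ℤ
    b<0   : b < 0ℤ

mExp : ℕ → ℤ → ℕ
mExp n c = if does (2 ND.∣? ℤ.∣ c ∣) then n else 0

-- Θ_n(a,b,c) = (-2^{-m}(a-b)^n, -2^{-m}[c^n-(a-b)^n], 2^{-m}c^n)
-- (the divisions are exact for ABC-solutions; _/ℕ_ is floor division).
Θ : ℕ → ℤ → ℤ → ℤ → ℤ × ℤ × ℤ
Θ n a b c =
  ( - (((a - b) ^ n) /ℕ d)
  , - (((c ^ n) - (a - b) ^ n) /ℕ d)
  , ((c ^ n) /ℕ d) )
  where
  d = 2 ℕ.^ mExp n c
  instance
    d≢0 : ℕ.NonZero d
    d≢0 = m^n≢0 2 (mExp n c)

{-# OPTIONS --safe #-}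
-- Dividing out the power of 2 gives Θₙ(a, b, c) = (−Yⁿ, −(Xⁿ − Yⁿ), Xⁿ) with
-- (X, Y) = (c, a − b), or (c/2, (a − b)/2) when c is even, so ABC = XⁿYⁿ(Xⁿ − Yⁿ) and it suffices
-- that z²ⁿ ≡ zⁿ mod N for every integer z. Split N = u v with u = gcd(zⁿ⁺¹, N), the part of N made
-- of primes dividing z: then u ∣ zⁿ and v is coprime to z, so z + v is a unit mod N and Euler's
-- theorem for it gives zⁿ ≡ 1 mod v. Euler's theorem itself comes from multiplication by a unit
-- permuting the list of totatives.
module Submission where

open import Data.Nat using (ℕ; zero; suc; _≤_; _<_; s≤s; z≤n; z<s; NonZero)
open import Defs using (φ; IsABC; Θ; mExp)
open import Data.Nat.Coprimality using (Coprime)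
open import Data.Product using (∃₂; _×_; _,_; proj₁; proj₂)
open import Relation.Binary.PropositionalEquality

module _ where
  open import Data.Nat using (_*_; _^_; _∸_; ≢-nonZero)
  open import Data.Nat.Properties
  open import Data.Nat.Divisibility
  open import Data.Nat.GCD using (gcd; gcd[m,n]∣m; gcd[m,n]∣n; gcd[m,n]≡0⇒n≡0; gcd-greatest)
  open import Data.Nat.Coprimality using (coprime-divisor; gcd≡1⇒coprime)
  import Data.Nat.Coprimality as Coprimality
  open import Induction.WellFounded using (Acc; acc)
  open import Data.Nat.Induction using (<-wellFounded)
  open import Data.Nat.DivMod using (_%_; _/_; m≡m%n+[m/n]*n)
  open import Data.Nat.ListAction using (product)
  open import Data.List using ([]; _∷_)
  open import Data.List.Membership.Propositional using (_∈_)
  open import Data.List.Relation.Unary.Any using (here; there)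
  open import Function.Base using (_∘′_)
  open import Relation.Nullary using (contradiction)

  coprime-* : ∀ {m n o} → Coprime m n → Coprime m o → Coprime m (n * o)
  coprime-* {m} {n} m⊥n m⊥o {d} (d∣m , d∣n*o) = m⊥o (d∣m , coprime-divisor d⊥n d∣n*o)
    where
    d⊥n : Coprime d n
    d⊥n (e∣d , e∣n) = m⊥n (∣-trans e∣d d∣m , e∣n)

  coprime-^ : ∀ {m n} → Coprime m n → ∀ k → Coprime m (n ^ k)
  coprime-^ _   zero    (_ , d∣1) = ∣1⇒≡1 d∣1
  coprime-^ m⊥n (suc k) = coprime-* m⊥n (coprime-^ m⊥n k)

  coprime∧∣^⇒≡1 : ∀ {d x k} → Coprime d x → d ∣ x ^ k → d ≡ 1
  coprime∧∣^⇒≡1 {k = k} d⊥x d∣xᵏ = coprime-^ d⊥x k (∣-refl , d∣xᵏ)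

  coprime-1+* : ∀ {m k} j → m ∣ k → Coprime (suc (j * k)) m
  coprime-1+* {k = k} j m∣k {d} (d∣1+jk , d∣m) =
    ∣1⇒≡1 (∣m+n∣m⇒∣n (subst (d ∣_) (+-comm 1 (j * k)) d∣1+jk) (∣n⇒∣m*n j (∣-trans d∣m m∣k)))

  coprime-gcd⇒coprime : ∀ {a x u M} → Coprime a (gcd x u) → u ∣ x ^ M → Coprime a u
  coprime-gcd⇒coprime {x = x} {M = M} a⊥g u∣xᴹ {d} (d∣a , d∣u) =
    coprime∧∣^⇒≡1 {k = M} d⊥x (∣-trans d∣u u∣xᴹ)
    where
    d⊥x : Coprime d x
    d⊥x (e∣d , e∣x) = a⊥g (∣-trans e∣d d∣a , gcd-greatest e∣x (∣-trans e∣d d∣u))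

  coprime-% : ∀ {N m} .{{_ : NonZero N}} → Coprime N m → Coprime N (m % N)
  coprime-% {N} {m} N⊥m {d} (d∣N , d∣m%N) =
    N⊥m (d∣N , subst (d ∣_) (sym (m≡m%n+[m/n]*n m N)) (∣m∣n⇒∣m+n d∣m%N (∣n⇒∣m*n (m / N) d∣N)))

  coprime-product : ∀ {m ns} → (∀ {n} → n ∈ ns → Coprime m n) → Coprime m (product ns)
  coprime-product {ns = []}     _      (_ , d∣1) = ∣1⇒≡1 d∣1
  coprime-product {ns = n ∷ ns} m⊥all = coprime-* (m⊥all (here refl)) (coprime-product (m⊥all ∘′ there))

  ^-monoʳ-∣ : ∀ x {m n} → m ≤ n → x ^ m ∣ x ^ n
  ^-monoʳ-∣ x {m} {n} m≤n = subst (x ^ m ∣_) xᵐ⁺⁽ⁿ⁻ᵐ⁾≡xⁿ (m∣m*n (x ^ (n ∸ m)))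
    where
    xᵐ⁺⁽ⁿ⁻ᵐ⁾≡xⁿ : x ^ m * x ^ (n ∸ m) ≡ x ^ n
    xᵐ⁺⁽ⁿ⁻ᵐ⁾≡xⁿ = trans (sym (^-distribˡ-+-* x m (n ∸ m))) (cong (x ^_) (m+[n∸m]≡n m≤n))

  2≤gcd : ∀ {m n o} → 2 ≤ m → m ∣ n ^ o → 2 ≤ gcd n m
  2≤gcd {m} {n} {o} 2≤m m∣nᵒ with gcd n m in eq
  ... | 0 = contradiction (gcd[m,n]≡0⇒n≡0 n eq) (>⇒≢ (<-trans z<s 2≤m))
  ... | 1 = contradiction (coprime∧∣^⇒≡1 {k = o} (Coprimality.sym (gcd≡1⇒coprime eq)) m∣nᵒ) (>⇒≢ 2≤m)
  ... | suc (suc _) = s≤s (s≤s z≤n)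

  -- Recurse on m′ = m / gcd(n, m), which is smaller than m because gcd(n, m) ≥ 2.
  m∣n^o⇒m*n∣n^m : ∀ {n o} m .{{_ : NonZero m}} → m ∣ n ^ o → m * n ∣ n ^ m
  m∣n^o⇒m*n∣n^m {n} {o} m = go m (<-wellFounded m)
    where
    go : ∀ m → Acc _<_ m → .{{_ : NonZero m}} → m ∣ n ^ o → m * n ∣ n ^ m
    go 1               _         _    = ∣-reflexive (sym (*-comm n 1))
    go m@(suc (suc _)) (acc rec) m∣nᵒ = ∣-trans mn∣nᵐ′⁺¹ (^-monoʳ-∣ n m′<m)
      where
      g  = gcd n m
      m′ = quotient (gcd[m,n]∣n n m)
      m≡m′g : m ≡ m′ * g
      m≡m′g = m∣n⇒n≡quotient*m (gcd[m,n]∣n n m)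
      instance
        m′≢0 : NonZero m′
        m′≢0 = ≢-nonZero λ m′≡0 → 1+n≢0 (trans m≡m′g (cong (_* g) m′≡0))
      m′<m : m′ < m
      m′<m = subst (m′ <_) (sym m≡m′g) (m<m*n m′ g (2≤gcd {o = o} (s≤s (s≤s z≤n)) m∣nᵒ))
      m′n∣nᵐ′ : m′ * n ∣ n ^ m′
      m′n∣nᵐ′ = go m′ (rec m′<m) (∣-trans (quotient-∣ (gcd[m,n]∣n n m)) m∣nᵒ)
      mn∣nᵐ′⁺¹ : m * n ∣ n ^ suc m′
      mn∣nᵐ′⁺¹ = subst₂ _∣_ m′ng≡mn (*-comm (n ^ m′) n) (*-pres-∣ m′n∣nᵐ′ (gcd[m,n]∣m n m))
        where
        m′ng≡mn : m′ * n * g ≡ m * n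
        m′ng≡mn = trans (*-assoc m′ n g) (trans (cong (m′ *_) (*-comm n g))
                    (trans (sym (*-assoc m′ g n)) (cong (_* n) (sym m≡m′g))))

module _ {a} {A : Set a} where
  open import Data.Fin using (Fin; zero; suc)
  open import Data.Fin.Properties using (injective⇒≤)
  open import Data.List using (List; _∷_; length; lookup; map)
  open import Data.List.Properties using (length-map; map-tabulate; tabulate-lookup)
  open import Data.List.Membership.Propositional using (_∈_)
  open import Data.List.Membership.Propositional.Properties using (∈-lookup; ∈-map⁻)
  open import Data.List.Membership.Propositional.Properties.WithK using (unique∧set⇒bag)
  open import Data.List.Relation.Binary.BagAndSetEquality using (∼bag⇒↭)
  open import Data.List.Relation.Binary.Permutation.Propositional using (_↭_)
  open import Data.List.Relation.Binary.Subset.Propositional using (_⊆_)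
  open import Data.List.Relation.Unary.Any using (here; there; index)
  open import Data.List.Relation.Unary.Any.Properties using (lookup-index)
  import Data.List.Relation.Unary.All as All
  open import Data.List.Relation.Unary.AllPairs using (_∷_)
  open import Data.List.Relation.Unary.All.Properties using (¬Any⇒All¬)
  open import Data.List.Relation.Unary.Unique.Propositional using (Unique)
  open import Data.List.Relation.Unary.Unique.Propositional.Properties using (tabulate⁺)
  open import Data.Nat.Properties using (≤-reflexive; ≤-trans; <-irrefl)
  open import Function.Bundles using (mk⇔)
  open import Relation.Binary.Definitions using (DecidableEquality)
  open import Relation.Nullary using (yes; no; contradiction)

  lookup-injective : ∀ {xs : List A} → Unique xs → ∀ {i j} → lookup xs i ≡ lookup xs j → i ≡ j
  lookup-injective {_ ∷ _} _         {zero}  {zero}  _  = refl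
  lookup-injective {_ ∷ _} (x≢ ∷ _)  {zero}  {suc j} eq = contradiction eq (All.lookup x≢ (∈-lookup j))
  lookup-injective {_ ∷ _} (x≢ ∷ _)  {suc i} {zero}  eq = contradiction (sym eq) (All.lookup x≢ (∈-lookup i))
  lookup-injective {_ ∷ _} (_ ∷ !xs) {suc i} {suc j} eq = cong suc (lookup-injective !xs eq)

  injection⇒≤length : ∀ {m ys} (f : Fin m → A) → (∀ {i j} → f i ≡ f j → i ≡ j) →
                      (∀ i → f i ∈ ys) → m ≤ length ys
  injection⇒≤length {ys = ys} f f-inj f∈ys = injective⇒≤ {f = λ i → index (f∈ys i)} λ {i} {j} eq →
    f-inj (trans (lookup-index (f∈ys i)) (trans (cong (lookup ys) eq) (sym (lookup-index (f∈ys j)))))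

  Unique∧⊆⇒length≤ : ∀ {xs ys : List A} → Unique xs → xs ⊆ ys → length xs ≤ length ys
  Unique∧⊆⇒length≤ {xs} !xs xs⊆ys =
    injection⇒≤length (lookup xs) (lookup-injective !xs) (λ i → xs⊆ys (∈-lookup i))

  module _ (_≟_ : DecidableEquality A) where
    open import Data.List.Membership.DecPropositional _≟_ using (_∈?_)

    Unique∧⊆∧length≥⇒⊇ : ∀ {xs ys : List A} → Unique xs → xs ⊆ ys →
                         length ys ≤ length xs → ys ⊆ xs
    Unique∧⊆∧length≥⇒⊇ {xs} {ys} !xs xs⊆ys ys≤xs {y} y∈ys with y ∈? xs
    ... | yes y∈xs = y∈xs
    ... | no  y∉xs =
      contradiction (≤-trans (Unique∧⊆⇒length≤ (¬Any⇒All¬ xs y∉xs ∷ !xs) y∷xs⊆ys) ys≤xs) (<-irrefl refl)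
      where
      y∷xs⊆ys : y ∷ xs ⊆ ys
      y∷xs⊆ys (here refl) = y∈ys
      y∷xs⊆ys (there p)   = xs⊆ys p

    injective-endo⇒map-↭ : ∀ {xs : List A} (f : A → A) → Unique xs → (∀ {x} → x ∈ xs → f x ∈ xs) →
                           (∀ {x y} → x ∈ xs → y ∈ xs → f x ≡ f y → x ≡ y) → map f xs ↭ xs
    injective-endo⇒map-↭ {xs} f !xs f∈xs f-inj = ∼bag⇒↭ (unique∧set⇒bag !fxs !xs (mk⇔ fxs⊆xs xs⊆fxs))
      where
      !fxs : Unique (map f xs)
      !fxs = subst Unique (trans (sym (map-tabulate (lookup xs) f)) (cong (map f) (tabulate-lookup xs)))
        (tabulate⁺ λ eq → lookup-injective !xs (f-inj (∈-lookup _) (∈-lookup _) eq))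
      fxs⊆xs : map f xs ⊆ xs
      fxs⊆xs p with x , x∈xs , refl ← ∈-map⁻ f p = f∈xs x∈xs
      xs⊆fxs : xs ⊆ map f xs
      xs⊆fxs = Unique∧⊆∧length≥⇒⊇ !fxs fxs⊆xs (≤-reflexive (sym (length-map f xs)))

module _ where
  open import Data.Nat using (_*_; _≟_)
  open import Data.Nat.Properties using (suc-injective; *-cancelʳ-≡; *-monoˡ-<; ≤∧≢⇒<; <⇒≤; >⇒≢)
  open import Data.Nat.Divisibility using (∣-refl)
  open import Data.Nat.GCD using (gcd)
  open import Data.Nat.Coprimality using (coprime⇒gcd≡1; gcd≡1⇒coprime; 0-coprimeTo-m⇒m≡1)
  open import Data.Fin using (toℕ)
  open import Data.Fin.Properties using (toℕ-injective; toℕ<n)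
  open import Data.List using (List; map; filter; upTo; length)
  open import Data.List.Properties using (length-map)
  open import Data.List.Membership.Propositional using (_∈_)
  open import Data.List.Membership.Propositional.Properties
    using (∈-map⁺; ∈-map⁻; ∈-filter⁺; ∈-filter⁻; ∈-upTo⁺; ∈-upTo⁻)
  open import Data.List.Relation.Unary.Unique.Propositional using (Unique)
  import Data.List.Relation.Unary.Unique.Propositional.Properties as Unique
  open import Relation.Nullary using (contradiction)

  totatives : ℕ → List ℕ
  totatives N = map suc (filter (λ k → gcd (suc k) N ≟ 1) (upTo N))

  length-totatives : ∀ N → length (totatives N) ≡ φ N
  length-totatives N = length-map suc (filter (λ k → gcd (suc k) N ≟ 1) (upTo N))

  Unique-totatives : ∀ N → Unique (totatives N)
  Unique-totatives N = Unique.map⁺ suc-injective (Unique.filter⁺ _ (Unique.upTo⁺ N))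

  ∈-totatives⁺ : ∀ {N k} → suc k ≤ N → Coprime (suc k) N → suc k ∈ totatives N
  ∈-totatives⁺ k<N k+1⊥N = ∈-map⁺ suc (∈-filter⁺ _ (∈-upTo⁺ k<N) (coprime⇒gcd≡1 k+1⊥N))

  ∈-totatives⁺′ : ∀ {N w} → 2 ≤ N → w < N → Coprime w N → w ∈ totatives N
  ∈-totatives⁺′ {w = zero}  2≤N _   0⊥N = contradiction (0-coprimeTo-m⇒m≡1 0⊥N) (>⇒≢ 2≤N)
  ∈-totatives⁺′ {w = suc _} _   w<N w⊥N = ∈-totatives⁺ (<⇒≤ w<N) w⊥N

  ∈-totatives⁻ : ∀ {N w} → 2 ≤ N → w ∈ totatives N → w < N × Coprime w N
  ∈-totatives⁻ {N} 2≤N w∈ with k , k∈ , refl ← ∈-map⁻ suc w∈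
                           with k∈upTo , gcd≡1 ← ∈-filter⁻ _ k∈ =
    ≤∧≢⇒< (∈-upTo⁻ k∈upTo) k+1≢N , gcd≡1⇒coprime gcd≡1
    where
    k+1≢N : suc k ≢ N
    k+1≢N refl = >⇒≢ 2≤N (gcd≡1⇒coprime gcd≡1 (∣-refl , ∣-refl))

  φ-lowerBound : ∀ {N q s} .{{_ : NonZero s}} → N ≡ q * s →
                 (∀ {j} → j < q → Coprime (suc (j * s)) N) → q ≤ φ N
  φ-lowerBound {N} {q} {s} N≡qs units = subst (q ≤_) (length-totatives N)
    (injection⇒≤length (λ j → suc (toℕ j * s))
      (λ eq → toℕ-injective (*-cancelʳ-≡ _ _ s (suc-injective eq)))
      (λ j → ∈-totatives⁺ (subst (toℕ j * s <_) (sym N≡qs) (*-monoˡ-< s (toℕ<n j))) (units (toℕ<n j))))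

module _ where
  open import Data.Nat using (_*_; _^_; ≢-nonZero; ≢-nonZero⁻¹)
  open import Data.Nat.Properties using (*-assoc; *-comm; *-identityˡ; *-zeroʳ)
  open import Data.Nat.Divisibility
  open import Data.Nat.GCD using (gcd; gcd[m,n]∣m; gcd[m,n]∣n; gcd[m,n]≢0; gcd-greatest)
  open import Data.Sum using (inj₂)

  -- With g = gcd(x, u) and q = u / g, u ∣ q x ∣ xᵠ, and the q numbers 1 + j g v are totatives,
  -- so q ≤ φ N. A common factor h of v and x would make h u divide gcd(xⁿ⁺¹, N) = u.
  φ-split : ∀ {N} .{{_ : NonZero N}} x → ∃₂ λ u v → N ≡ u * v × u ∣ x ^ φ N × Coprime v x
  φ-split {N} x = u , v , N≡uv , u∣xⁿ , v⊥x
    where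
    n = φ N
    u∣N = gcd[m,n]∣n (x ^ suc n) N
    u = gcd (x ^ suc n) N
    v = quotient u∣N
    u∣xⁿ⁺¹ : u ∣ x ^ suc n
    u∣xⁿ⁺¹ = gcd[m,n]∣m (x ^ suc n) N
    N≡uv : N ≡ u * v
    N≡uv = m∣n⇒n≡m*quotient u∣N
    instance
      u≢0 : NonZero u
      u≢0 = ≢-nonZero (gcd[m,n]≢0 (x ^ suc n) N (inj₂ (≢-nonZero⁻¹ N)))
    g∣u = gcd[m,n]∣n x u
    g = gcd x u
    q = quotient g∣u
    s = g * v
    N≡qs : N ≡ q * s
    N≡qs = trans N≡uv (trans (cong (_* v) (m∣n⇒n≡quotient*m g∣u)) (*-assoc q g v))
    instance
      q≢0 : NonZero q
      q≢0 = quotient≢0 g∣u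
      s≢0 : NonZero s
      s≢0 = ≢-nonZero λ s≡0 → ≢-nonZero⁻¹ N (trans N≡qs (trans (cong (q *_) s≡0) (*-zeroʳ q)))
    units : ∀ {j} → j < q → Coprime (suc (j * s)) N
    units {j} _ = subst (Coprime _) (sym N≡uv)
      (coprime-* (coprime-gcd⇒coprime {x = x} {M = suc n} (coprime-1+* j (m∣m*n v)) u∣xⁿ⁺¹)
                 (coprime-1+* j (n∣m*n g)))
    u∣xⁿ : u ∣ x ^ n
    u∣xⁿ = ∣-trans (subst (_∣ q * x) (sym (m∣n⇒n≡quotient*m g∣u)) (*-monoʳ-∣ q (gcd[m,n]∣m x u)))
             (∣-trans (m∣n^o⇒m*n∣n^m {x} {o = suc n} q (∣-trans (quotient-∣ g∣u) u∣xⁿ⁺¹))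
                      (^-monoʳ-∣ x (φ-lowerBound N≡qs units)))
    v⊥x : Coprime v x
    v⊥x {h} (h∣v , h∣x) = ∣1⇒≡1 (*-cancelʳ-∣ u (subst (h * u ∣_) (sym (*-identityˡ u)) hu∣u))
      where
      hu∣u : h * u ∣ u
      hu∣u = gcd-greatest (*-pres-∣ h∣x u∣xⁿ)
               (subst (h * u ∣_) (sym (trans N≡uv (*-comm u v))) (*-monoˡ-∣ u h∣v))

module _ where
  open import Data.Nat using (_⊔_) renaming (_*_ to _*ℕ_)
  open import Data.Nat.Properties using (≤-<-trans; ⊔-lub; *-comm)
  import Data.Nat.Divisibility as ℕ
  open import Data.Nat.Coprimality using (coprime-divisor)
  open import Data.Integer using (ℤ; +_; _+_; _-_; _*_; -_; _^_; ∣_∣; 0ℤ; _%ℕ_; _/ℕ_)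
  open import Data.Integer.Properties
    using (+-inverseʳ; +-injective; m-n≡m⊖n; ∣m⊝n∣≤m⊔n; ∣i∣≡0⇒i≡0; i-j≡0⇒i≡j; abs-*)
  open import Data.Integer.DivMod using (a≡a%ℕn+[a/ℕn]*n)
  open import Data.Integer.Divisibility.Signed
    using (_∣_; divides; ∣m∣n⇒∣m+n; ∣m⇒∣-m; ∣n⇒∣m*n; ∣m⇒∣m*n; ∣⇒∣ᵤ; ∣ᵤ⇒∣; ∣-trans)
  open import Data.Integer.Tactic.RingSolver using (solve-∀)
  open import Relation.Binary.Bundles using (Setoid)
  open import Relation.Nullary using (contradiction)
  open import Data.Nat.Divisibility using (>⇒∤)

  infix 4 _≡_mod_
  record _≡_mod_ (a b : ℤ) (N : ℕ) : Set where
    constructor congruent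
    field modulus∣difference : + N ∣ a - b

  ≡mod-refl : ∀ {N a} → a ≡ a mod N
  ≡mod-refl {N} {a} = congruent (divides 0ℤ (+-inverseʳ a))

  ≡⇒≡mod : ∀ {N a b} → a ≡ b → a ≡ b mod N
  ≡⇒≡mod refl = ≡mod-refl

  ≡mod-sym : ∀ {N a b} → a ≡ b mod N → b ≡ a mod N
  ≡mod-sym {N} {a} {b} (congruent N∣a-b) = congruent (subst (+ N ∣_) (-[a-b]≡b-a a b) (∣m⇒∣-m N∣a-b))
    where
    -[a-b]≡b-a : ∀ a b → - (a - b) ≡ b - a
    -[a-b]≡b-a = solve-∀

  ≡mod-trans : ∀ {N a b c} → a ≡ b mod N → b ≡ c mod N → a ≡ c mod N
  ≡mod-trans {N} {a} {b} {c} (congruent N∣a-b) (congruent N∣b-c) =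
    congruent (subst (+ N ∣_) (telescope a b c) (∣m∣n⇒∣m+n N∣a-b N∣b-c))
    where
    telescope : ∀ a b c → (a - b) + (b - c) ≡ a - c
    telescope = solve-∀

  ≡mod-setoid : ℕ → Setoid _ _
  ≡mod-setoid N = record
    { Carrier = ℤ
    ; _≈_ = _≡_mod N
    ; isEquivalence = record { refl = ≡mod-refl ; sym = ≡mod-sym ; trans = ≡mod-trans }
    }

  ≡mod-minus : ∀ {N a b c d} → a ≡ b mod N → c ≡ d mod N → a - c ≡ b - d mod N
  ≡mod-minus {N} {a} {b} {c} {d} (congruent N∣a-b) (congruent N∣c-d) =
    congruent (subst (+ N ∣_) (regroup a b c d) (∣m∣n⇒∣m+n N∣a-b (∣m⇒∣-m N∣c-d)))
    where
    regroup : ∀ a b c d → (a - b) + - (c - d) ≡ (a - c) - (b - d)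
    regroup = solve-∀

  ≡mod-* : ∀ {N a b c d} → a ≡ b mod N → c ≡ d mod N → a * c ≡ b * d mod N
  ≡mod-* {N} {a} {b} {c} {d} (congruent N∣a-b) (congruent N∣c-d) =
    congruent (subst (+ N ∣_) (regroup a b c d) (∣m∣n⇒∣m+n (∣m⇒∣m*n c N∣a-b) (∣n⇒∣m*n b N∣c-d)))
    where
    regroup : ∀ a b c d → (a - b) * c + b * (c - d) ≡ a * c - b * d
    regroup = solve-∀

  ≡mod-^ : ∀ {N a b} k → a ≡ b mod N → a ^ k ≡ b ^ k mod N
  ≡mod-^ zero    _   = ≡mod-refl
  ≡mod-^ (suc k) a≡b = ≡mod-* a≡b (≡mod-^ k a≡b)

  ≡mod-∣ : ∀ {N v a b} → v ℕ.∣ N → a ≡ b mod N → a ≡ b mod v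
  ≡mod-∣ v∣N (congruent N∣a-b) = congruent (∣-trans (∣ᵤ⇒∣ v∣N) N∣a-b)

  %ℕ-≡mod : ∀ z N .{{_ : NonZero N}} → + (z %ℕ N) ≡ z mod N
  %ℕ-≡mod z N = congruent (divides (- (z /ℕ N))
    (trans (cong (λ t → + (z %ℕ N) - t) (a≡a%ℕn+[a/ℕn]*n z N)) (cancel (+ (z %ℕ N)) (z /ℕ N) (+ N))))
    where
    cancel : ∀ r q n → r - (r + q * n) ≡ (- q) * n
    cancel = solve-∀

  ≡mod⇒≡ : ∀ {N a b} → a < N → b < N → + a ≡ + b mod N → a ≡ b
  ≡mod⇒≡ {N} {a} {b} a<N b<N (congruent N∣a-b) =
    +-injective (i-j≡0⇒i≡j (+ a) (+ b) (∣i∣≡0⇒i≡0 ∣a-b∣≡0))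
    where
    ∣a-b∣<N : ∣ + a - + b ∣ < N
    ∣a-b∣<N = ≤-<-trans (subst (_≤ a ⊔ b) (cong ∣_∣ (sym (m-n≡m⊖n a b))) (∣m⊝n∣≤m⊔n a b))
                        (⊔-lub a<N b<N)
    ∣a-b∣≡0 : ∣ + a - + b ∣ ≡ 0
    ∣a-b∣≡0 with ∣ + a - + b ∣ | ∣a-b∣<N | ∣⇒∣ᵤ N∣a-b
    ... | zero  | _   | _   = refl
    ... | suc _ | k<N | N∣k = contradiction N∣k (>⇒∤ k<N)

  ≡mod-cancelʳ : ∀ {N P a b} → Coprime N P → a * + P ≡ b * + P mod N → a ≡ b mod N
  ≡mod-cancelʳ {N} {P} {a} {b} N⊥P (congruent N∣aP-bP) =
    congruent (∣ᵤ⇒∣ (coprime-divisor N⊥P N∣P∣a-b∣))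
    where
    N∣P∣a-b∣ : N ℕ.∣ P *ℕ ∣ a - b ∣
    N∣P∣a-b∣ = subst (N ℕ.∣_) (trans (abs-* (a - b) (+ P)) (*-comm ∣ a - b ∣ P))
      (∣⇒∣ᵤ (subst (+ N ∣_) (factor a b (+ P)) N∣aP-bP))
      where
      factor : ∀ a b p → a * p - b * p ≡ (a - b) * p
      factor = solve-∀

module _ where
  open import Data.Nat using (_%_; >-nonZero) renaming (_*_ to _*ℕ_; _≟_ to _≟ℕ_)
  open import Data.Nat.DivMod using (m%n<n)
  open import Data.Nat.ListAction using (product)
  open import Data.Nat.ListAction.Properties using (product-↭)
  open import Data.Nat.Properties using (<-trans)
  import Data.Nat.Coprimality as Coprimality
  open import Data.Integer using (+_; _*_; _^_; 1ℤ)
  open import Data.Integer.Properties using (pos-*; *-identityˡ; *-comm)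
  open import Data.Integer.Tactic.RingSolver using (solve-∀)
  open import Data.List using ([]; _∷_; map; length)
  open import Data.List.Membership.Propositional using (_∈_)
  open import Data.List.Relation.Binary.Permutation.Propositional using (_↭_)

  -- Multiplication by x permutes the totatives; compare the products of both sides.
  euler : ∀ {N x} → 2 ≤ N → Coprime x N → (+ x) ^ φ N ≡ 1ℤ mod N
  euler {N} {x} 2≤N x⊥N = ≡mod-cancelʳ N⊥P (begin
      (+ x) ^ φ N * + P       ≡⟨ cong (λ k → (+ x) ^ k * + P) (sym (length-totatives N)) ⟩
      (+ x) ^ length V * + P  ≈⟨ ≡mod-sym (product-map-f V) ⟩
      + product (map f V)     ≡⟨ cong +_ (product-↭ fV↭V) ⟩
      + P                     ≡⟨ sym (*-identityˡ (+ P)) ⟩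
      1ℤ * + P                ∎)
    where
    open import Relation.Binary.Reasoning.Setoid (≡mod-setoid N)
    instance
      N≢0 : NonZero N
      N≢0 = >-nonZero (<-trans z<s 2≤N)
    V = totatives N
    P = product V
    f : ℕ → ℕ
    f w = (x *ℕ w) % N
    N⊥P : Coprime N P
    N⊥P = coprime-product (λ w∈V → Coprimality.sym (proj₂ (∈-totatives⁻ 2≤N w∈V)))
    f≡x* : ∀ w → + f w ≡ + x * + w mod N
    f≡x* w = ≡mod-trans (%ℕ-≡mod (+ (x *ℕ w)) N) (≡⇒≡mod (pos-* x w))
    f∈V : ∀ {w} → w ∈ V → f w ∈ V
    f∈V {w} w∈V = ∈-totatives⁺′ 2≤N (m%n<n (x *ℕ w) N) (Coprimality.sym (coprime-%
      (coprime-* (Coprimality.sym x⊥N) (Coprimality.sym (proj₂ (∈-totatives⁻ 2≤N w∈V))))))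
    f-injective : ∀ {a b} → a ∈ V → b ∈ V → f a ≡ f b → a ≡ b
    f-injective {a} {b} a∈V b∈V fa≡fb =
      ≡mod⇒≡ (proj₁ (∈-totatives⁻ 2≤N a∈V)) (proj₁ (∈-totatives⁻ 2≤N b∈V))
        (≡mod-cancelʳ (Coprimality.sym x⊥N) (begin
        + a * + x  ≡⟨ *-comm (+ a) (+ x) ⟩
        + x * + a  ≈⟨ ≡mod-sym (f≡x* a) ⟩
        + f a      ≡⟨ cong +_ fa≡fb ⟩
        + f b      ≈⟨ f≡x* b ⟩
        + x * + b  ≡⟨ *-comm (+ x) (+ b) ⟩
        + b * + x  ∎))
    fV↭V : map f V ↭ V
    fV↭V = injective-endo⇒map-↭ _≟ℕ_ f (Unique-totatives N) f∈V f-injective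
    product-map-f : ∀ ws → + product (map f ws) ≡ (+ x) ^ length ws * + product ws mod N
    product-map-f []       = ≡mod-refl
    product-map-f (w ∷ ws) = begin
      + (f w *ℕ product (map f ws))                     ≡⟨ pos-* (f w) (product (map f ws)) ⟩
      + f w * + product (map f ws)                      ≈⟨ ≡mod-* (f≡x* w) (product-map-f ws) ⟩
      (+ x * + w) * ((+ x) ^ length ws * + product ws)  ≡⟨ regroup (+ x) (+ w) ((+ x) ^ length ws) (+ product ws) ⟩
      xᵏ⁺¹ * (+ w * + product ws)                       ≡⟨ cong (xᵏ⁺¹ *_) (sym (pos-* w (product ws))) ⟩
      xᵏ⁺¹ * + product (w ∷ ws)                         ∎
      where
      xᵏ⁺¹ = (+ x) ^ length (w ∷ ws)
      regroup : ∀ x w xᵏ p → (x * w) * (xᵏ * p) ≡ (x * xᵏ) * (w * p)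
      regroup = solve-∀

module _ where
  open import Data.Nat using (>-nonZero; >-nonZero⁻¹) renaming (_+_ to _+ℕ_; _*_ to _*ℕ_; _^_ to _^ℕ_)
  open import Data.Nat.Properties using (+-comm; m^n≢0; <-trans)
  open import Data.Nat.Divisibility using (∣-trans; n∣m*n) renaming (_∣_ to _∣ℕ_; _∣?_ to _∣ℕ?_)
  open import Data.Nat.GCD using (gcd[m,n]∣m)
  open import Data.Nat.Coprimality using (coprime-+)
  import Data.Nat.Coprimality as Coprimality
  open import Data.Integer using (+_; _+_; _-_; _*_; -_; _^_; ∣_∣; 0ℤ; 1ℤ; -1ℤ; _%ℕ_; _/ℕ_)
  open import Data.Integer.Properties
    using (pos-*; pos-+; *-cancelʳ-≡; +-identityˡ; +-identityʳ; *-identityʳ; +-inverseʳ; ^-zeroˡ)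
  open import Data.Integer.DivMod using (n%ℕd<d; a≡a%ℕn+[a/ℕn]*n)
  open import Data.Integer.Divisibility using () renaming (_∣_ to _∣ᵤ_)
  open import Data.Integer.Divisibility.Signed using (_∣_; divides; ∣⇒∣ᵤ; ∣ᵤ⇒∣)
  open import Data.Integer.Tactic.RingSolver using (solve-∀)
  open import Data.Bool using (if_then_else_)
  open import Relation.Nullary using (¬_; yes; no)
  open import Relation.Nullary.Decidable using (dec-true; dec-false)

  pos-^ : ∀ m n → + (m ^ℕ n) ≡ (+ m) ^ n
  pos-^ m zero    = refl
  pos-^ m (suc n) = trans (pos-* m (m ^ℕ n)) (cong (+ m *_) (pos-^ m n))

  ^-distribʳ-* : ∀ i j n → (i * j) ^ n ≡ i ^ n * j ^ n
  ^-distribʳ-* i j zero    = refl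
  ^-distribʳ-* i j (suc n) = trans (cong ((i * j) *_) (^-distribʳ-* i j n)) (interchange i j (i ^ n) (j ^ n))
    where
    interchange : ∀ a b c d → (a * b) * (c * d) ≡ (a * c) * (b * d)
    interchange = solve-∀

  *-pres-∣ : ∀ {a b c d} → a ∣ b → c ∣ d → a * c ∣ b * d
  *-pres-∣ {a} {_} {c} (divides k refl) (divides l refl) = divides (k * l) (interchange k a l c)
    where
    interchange : ∀ a b c d → (a * b) * (c * d) ≡ (a * c) * (b * d)
    interchange = solve-∀

  -- Euler's theorem for the unit x + v gives xⁿ ≡ 1 mod v.
  split⇒pow-φ-idempotent : ∀ {N u v} x → 2 ≤ N → N ≡ u *ℕ v → u ∣ℕ x ^ℕ φ N → Coprime v x →
                           (+ x) ^ φ N * (+ x) ^ φ N ≡ (+ x) ^ φ N mod N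
  split⇒pow-φ-idempotent {N} {u} {v} x 2≤N N≡uv u∣xⁿ v⊥x =
    congruent (subst₂ _∣_ (trans (sym (pos-* u v)) (cong +_ (sym N≡uv))) (factor xⁿ)
      (*-pres-∣ (subst (+ u ∣_) (pos-^ x n) (∣ᵤ⇒∣ u∣xⁿ)) (_≡_mod_.modulus∣difference xⁿ≡1)))
    where
    n = φ N
    xⁿ = (+ x) ^ n
    factor : ∀ e → e * (e - 1ℤ) ≡ e * e - e
    factor = solve-∀
    x+v⊥x : Coprime (x +ℕ v) x
    x+v⊥x = coprime-+ v⊥x
    x+v⊥N : Coprime (x +ℕ v) N
    x+v⊥N = subst (Coprime (x +ℕ v)) (sym N≡uv) (coprime-*
      (coprime-gcd⇒coprime {x = x} {M = n} (λ (e∣x+v , e∣g) → x+v⊥x (e∣x+v , ∣-trans e∣g (gcd[m,n]∣m x _)))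
                                           u∣xⁿ)
      (subst (λ m → Coprime m v) (+-comm v x) (coprime-+ (Coprimality.sym v⊥x))))
    x≡x+v : + x ≡ + (x +ℕ v) mod v
    x≡x+v = congruent (divides -1ℤ (trans (cong (λ t → + x - t) (pos-+ x v)) (shift (+ x) (+ v))))
      where
      shift : ∀ x v → x - (x + v) ≡ -1ℤ * v
      shift = solve-∀
    xⁿ≡1 : xⁿ ≡ 1ℤ mod v
    xⁿ≡1 = ≡mod-trans (≡mod-^ n x≡x+v)
                      (≡mod-∣ (subst (v ∣ℕ_) (sym N≡uv) (n∣m*n u)) (euler 2≤N x+v⊥N))

  pos-pow-φ-idempotent : ∀ {N} → 2 ≤ N → ∀ x → (+ x) ^ φ N * (+ x) ^ φ N ≡ (+ x) ^ φ N mod N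
  pos-pow-φ-idempotent {N} 2≤N x =
    let u , v , N≡uv , u∣xⁿ , v⊥x = φ-split {N} {{>-nonZero (<-trans z<s 2≤N)}} x
    in  split⇒pow-φ-idempotent x 2≤N N≡uv u∣xⁿ v⊥x

  pow-φ-idempotent : ∀ {N} → 2 ≤ N → ∀ z → z ^ φ N * z ^ φ N ≡ z ^ φ N mod N
  pow-φ-idempotent {N} 2≤N z = begin
      z ^ n * z ^ n  ≈⟨ ≡mod-* (≡mod-^ n z≡r) (≡mod-^ n z≡r) ⟩
      r ^ n * r ^ n  ≈⟨ pos-pow-φ-idempotent 2≤N (z %ℕ N) ⟩
      r ^ n          ≈⟨ ≡mod-^ n (≡mod-sym z≡r) ⟩
      z ^ n          ∎
    where
    open import Relation.Binary.Reasoning.Setoid (≡mod-setoid N)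
    instance
      N≢0 : NonZero N
      N≢0 = >-nonZero (<-trans z<s 2≤N)
    n = φ N
    r = + (z %ℕ N)
    z≡r : z ≡ r mod N
    z≡r = ≡mod-sym (%ℕ-≡mod z N)

  -- With e = Xⁿ and f = Yⁿ the product is e²f − ef², and e² ≡ e, f² ≡ f.
  ∣Θ-product : ∀ {N} → 2 ≤ N → ∀ X Y → + N ∣ᵤ (- (Y ^ φ N)) * (- (X ^ φ N - Y ^ φ N)) * X ^ φ N
  ∣Θ-product {N} 2≤N X Y = ∣⇒∣ᵤ {+ N} {ABC} (subst (+ N ∣_) (+-identityʳ ABC)
    (_≡_mod_.modulus∣difference (begin
      ABC                        ≡⟨ expand e f ⟩
      (e * e) * f - e * (f * f)  ≈⟨ ≡mod-minus (≡mod-* {a = e * e} {e} {f} {f} (pow-φ-idempotent 2≤N X) ≡mod-refl)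
                                            (≡mod-* {a = e} {e} {f * f} {f} ≡mod-refl (pow-φ-idempotent 2≤N Y)) ⟩
      e * f - e * f              ≡⟨ +-inverseʳ (e * f) ⟩
      0ℤ                         ∎)))
    where
    open import Relation.Binary.Reasoning.Setoid (≡mod-setoid N)
    e = X ^ φ N
    f = Y ^ φ N
    ABC = (- f) * (- (e - f)) * e
    expand : ∀ e f → (- f) * (- (e - f)) * e ≡ (e * e) * f - e * (f * f)
    expand = solve-∀

  /ℕ-exact : ∀ {z w d} .{{_ : NonZero d}} → z ≡ w * + d → z /ℕ d ≡ w
  /ℕ-exact {z} {w} {d} z≡wd = *-cancelʳ-≡ (z /ℕ d) w (+ d) (begin
      z /ℕ d * + d               ≡⟨ sym (+-identityˡ (z /ℕ d * + d)) ⟩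
      + 0 + z /ℕ d * + d         ≡⟨ cong (λ r → + r + z /ℕ d * + d) (sym r≡0) ⟩
      + (z %ℕ d) + z /ℕ d * + d  ≡⟨ sym (a≡a%ℕn+[a/ℕn]*n z d) ⟩
      z                          ≡⟨ z≡wd ⟩
      w * + d                    ∎)
    where
    open ≡-Reasoning
    r≡0 : z %ℕ d ≡ 0
    r≡0 = ≡mod⇒≡ (n%ℕd<d z d) (>-nonZero⁻¹ d)
      (≡mod-trans (%ℕ-≡mod z d) (congruent (divides w (trans (+-identityʳ z) z≡wd))))

  mExp-even : ∀ n {c} → 2 ∣ℕ ∣ c ∣ → mExp n c ≡ n
  mExp-even n {c} 2∣c = cong (λ b → if b then n else 0) (dec-true (2 ∣ℕ? ∣ c ∣) 2∣c)

  mExp-odd : ∀ n {c} → ¬ 2 ∣ℕ ∣ c ∣ → mExp n c ≡ 0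
  mExp-odd n {c} 2∤c = cong (λ b → if b then n else 0) (dec-false (2 ∣ℕ? ∣ c ∣) 2∤c)

  Θ-scaled : ∀ n {a b c X Y t} → c ≡ X * t → a - b ≡ Y * t → + (2 ^ℕ mExp n c) ≡ t ^ n →
             Θ n a b c ≡ (- (Y ^ n) , - (X ^ n - Y ^ n) , X ^ n)
  Θ-scaled n {a} {b} {c} {X} {Y} {t} c≡Xt a-b≡Yt 2ᵐ≡tⁿ =
    cong₂ _,_ (cong -_ (/ℕ-exact [a-b]ⁿ≡Yⁿd))
              (cong₂ _,_ (cong -_ (/ℕ-exact cⁿ-[a-b]ⁿ≡[Xⁿ-Yⁿ]d)) (/ℕ-exact cⁿ≡Xⁿd))
    where
    instance
      2ᵐ≢0 : NonZero (2 ^ℕ mExp n c)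
      2ᵐ≢0 = m^n≢0 2 (mExp n c)
    scale : ∀ {z W} → z ≡ W * t → z ^ n ≡ W ^ n * + (2 ^ℕ mExp n c)
    scale {z} {W} z≡Wt = trans (cong (_^ n) z≡Wt) (trans (^-distribʳ-* W t n) (cong (W ^ n *_) (sym 2ᵐ≡tⁿ)))
    [a-b]ⁿ≡Yⁿd = scale a-b≡Yt
    cⁿ≡Xⁿd = scale c≡Xt
    cⁿ-[a-b]ⁿ≡[Xⁿ-Yⁿ]d =
      trans (cong₂ _-_ cⁿ≡Xⁿd [a-b]ⁿ≡Yⁿd) (factor (X ^ n) (Y ^ n) (+ (2 ^ℕ mExp n c)))
      where
      factor : ∀ p q r → p * r - q * r ≡ (p - q) * r
      factor = solve-∀

  Θ-shape : ∀ n {a b c} → a + b + c ≡ 0ℤ →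
            ∃₂ λ X Y → Θ n a b c ≡ (- (Y ^ n) , - (X ^ n - Y ^ n) , X ^ n)
  Θ-shape n {a} {b} {c} a+b+c≡0 with 2 ∣ℕ? ∣ c ∣
  ... | no 2∤c = c , a - b , Θ-scaled n {a} {b} {c} (sym (*-identityʳ c)) (sym (*-identityʳ (a - b)))
                   (trans (cong (λ m → + (2 ^ℕ m)) (mExp-odd n {c} 2∤c)) (sym (^-zeroˡ n)))
  ... | yes 2∣c with divides X c≡X2 ← ∣ᵤ⇒∣ {+ 2} {c} 2∣c =
    X , - X - b , Θ-scaled n {a} {b} {c} c≡X2 a-b≡Y2
                    (trans (cong (λ m → + (2 ^ℕ m)) (mExp-even n {c} 2∣c)) (pos-^ 2 n))
    where
    a-b≡Y2 : a - b ≡ (- X - b) * + 2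
    a-b≡Y2 = trans (rearrange a b c) (trans (cong₂ (λ s c → s - c - b * + 2) a+b+c≡0 c≡X2) (collect X b))
      where
      rearrange : ∀ a b c → a - b ≡ (a + b + c) - c - b * + 2
      rearrange = solve-∀
      collect : ∀ X b → 0ℤ - X * + 2 - b * + 2 ≡ (- X - b) * + 2
      collect = solve-∀

module _ where
  open import Data.Nat.Properties using (<⇒≤)
  open import Data.Integer using (ℤ; _*_; +_)
  open import Data.Integer.Divisibility using (_∣_)

  mainTheorem3 : (N : ℕ) → 3 ≤ N → (a b c : ℤ) → IsABC a b c →
    ∀ {A B C : ℤ} → Θ (φ N) a b c ≡ (A , B , C) → + N ∣ A * B * C
  mainTheorem3 N 3≤N a b c abc Θ≡ABC with X , Y , Θ≡ ← Θ-shape (φ N) {a} {b} {c} (IsABC.sum≡0 abc)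
    with refl ← trans (sym Θ≡ABC) Θ≡ = ∣Θ-product (<⇒≤ 3≤N) X Y
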